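{- Let $\mathcal U$ be a quasi-selective ultrafilter on $\mathbb N$ and let $g:\mathbb N\to\mathbb N$ be an unbounded interval-to-one function. Define $g^+(n)=\max\{x: g(x)=g(n)\}$, and let $e_g$ be the increasing enumeration of the range of $g^+$. Then the following are equivalent: (1) $g$ is $\mathcal U$-equivalent to a one-to-one function; (2) $g^+\in F_{\mathcal U}$; (3) there exists $U=\{u_0<u_1<\cdots<u_n<\cdots\}\in\mathcal U$ such that $u_n>e_g(n)$ for all $n$.
   Context: $\mathbb N=\{0,1,2,\dots\}$. $f\equiv_{\mathcal U}g$ means $\{n: f(n)=g(n)\}\in\mathcal U$. A nonprincipal ultrafilter $\mathcal U$ on $\mathbb N$ is quasi-selective if every $f:\mathbb N\to\mathbb N$ with $f(n)\le n$ for all $n$ is $\mathcal U$-equivalent to a nondecreasing function. A function $g$ is interval-to-one if each $g^{ -1}(n)$ is an interval of $\mathbb N$. $F_{\mathcal U}$ is the class of all nondecreasing $f:\mathbb N\to\mathbb N$ such that every $g:\mathbb N\to\mathbb N$ with $g\le f$ pointwise is $\mathcal U$-equivalent to some nondecreasing function. -}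

module Defs where

open import Data.Nat using (ℕ; _≤_; _<_)
open import Data.Product using (Σ; ∃; _×_; _,_)
open import Data.Sum using (_⊎_)
open import Data.Empty using (⊥)
open import Data.Unit using (⊤)
open import Relation.Nullary using (¬_)
open import Relation.Binary.PropositionalEquality using (_≡_; _≢_)
open import Function.Bundles using (_⇔_)

Subset : Set₁
Subset = ℕ → Set

record Ultrafilter : Set₁ where
  field
    _∈U     : Subset → Set
    upward  : ∀ {A B : Subset} → A ∈U → (∀ n → A n → B n) → B ∈U
    inter   : ∀ {A B : Subset} → A ∈U → B ∈U → (λ n → A n × B n) ∈U
    full    : (λ _ → ⊤) ∈U
    proper  : ¬ ((λ _ → ⊥) ∈U)
    ultra   : ∀ (A : Subset) → A ∈U ⊎ (λ n → ¬ A n) ∈U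

open Ultrafilter public

NonPrincipal : Ultrafilter → Set
NonPrincipal 𝒰 = ∀ k → _∈U 𝒰 (λ n → n ≢ k)

_≡[_]_ : (ℕ → ℕ) → Ultrafilter → (ℕ → ℕ) → Set
f ≡[ 𝒰 ] g = _∈U 𝒰 (λ n → f n ≡ g n)

Nondecreasing : (ℕ → ℕ) → Set
Nondecreasing f = ∀ {m n} → m ≤ n → f m ≤ f n

StrictlyIncreasing : (ℕ → ℕ) → Set
StrictlyIncreasing f = ∀ {m n} → m < n → f m < f n

Injective : (ℕ → ℕ) → Set
Injective f = ∀ {m n} → f m ≡ f n → m ≡ n

QuasiSelective : Ultrafilter → Set
QuasiSelective 𝒰 =
  NonPrincipal 𝒰 ×
  (∀ (f : ℕ → ℕ) → (∀ n → f n ≤ n) → ∃ λ h → Nondecreasing h × (f ≡[ 𝒰 ] h))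

IntervalToOne : (ℕ → ℕ) → Set
IntervalToOne g = ∀ {a b c} → a ≤ b → b ≤ c → g a ≡ g c → g b ≡ g a

Unbounded : (ℕ → ℕ) → Set
Unbounded g = ∀ m → ∃ λ n → m ≤ g n

IsGPlus : (ℕ → ℕ) → (ℕ → ℕ) → Set
IsGPlus g gp = ∀ n → (g (gp n) ≡ g n) × (∀ x → g x ≡ g n → x ≤ gp n)

IsIncreasingEnumOfRange : (ℕ → ℕ) → (ℕ → ℕ) → Set
IsIncreasingEnumOfRange f e =
  StrictlyIncreasing e ×
  (∀ n → ∃ λ m → f m ≡ e n) ×
  (∀ m → ∃ λ n → e n ≡ f m)

InF : Ultrafilter → (ℕ → ℕ) → Set
InF 𝒰 f = Nondecreasing f ×
  (∀ (g : ℕ → ℕ) → (∀ n → g n ≤ f n) → ∃ λ h → Nondecreasing h × (g ≡[ 𝒰 ] h))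

Range : (ℕ → ℕ) → Subset
Range u x = ∃ λ n → u n ≡ x

-- The fibres of g above e 0 are the blocks (e j, e (j + 1)], and g⁺ is constant on each
-- of them. If g is injective on a set D ∈ 𝒰, distinct points of D lie in distinct blocks,
-- so any f ≤ g⁺ is nondecreasing on {x ∈ D : x < f x}; on the complement f ≤ id and
-- quasi-selectivity applies. Picking one point of D in each block gives (3). Conversely, a
-- function that strictly decreases along every fibre (x ↦ g⁺ x ∸ x for (2); for (3), the
-- rank of the block of x minus the position of x in U) agrees with a nondecreasing function
-- only on a set where g is injective. Finally, a function injective on a set in 𝒰 is
-- 𝒰-equal to an injective one: keep it on the parity class of its values chosen by 𝒰 and
-- send every other point to the opposite parity.
module Submission where

open import Defs
open import Data.Nat using (ℕ; zero; suc; _*_; _∸_; _⊓_; _≤_; _<_; z≤n; s≤s; s≤s⁻¹; parity)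
open import Data.Nat.Properties
open import Data.Parity.Base using (Parity; 0ℙ; 1ℙ; _⁻¹)
import Data.Parity.Properties as ℙ
open import Data.Product using (∃; _×_; _,_; proj₁; proj₂)
open import Data.Sum using (inj₁; inj₂)
open import Data.Empty using (⊥-elim)
open import Function using (_∘_)
open import Function.Bundles using (_⇔_; mk⇔)
open import Relation.Nullary using (¬_; Dec; yes; no)
open import Relation.Nullary.Decidable using (_×-dec_)
open import Relation.Unary using (Decidable)
open import Relation.Binary using (tri<; tri≈; tri>)
open import Relation.Binary.PropositionalEquality

private
  variable
    D : Subset
    g u φ : ℕ → ℕ
    j x y z : ℕ

InjectiveOn : (ℕ → ℕ) → Subset → Set
InjectiveOn g D = ∀ {x y} → D x → D y → g x ≡ g y → x ≡ y

nondecreasing-by-steps : {H : ℕ → ℕ} → (∀ n → H n ≤ H (suc n)) → Nondecreasing H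
nondecreasing-by-steps step {m} {zero} z≤n = ≤-refl
nondecreasing-by-steps step {m} {suc n} m≤1+n with m≤n⇒m<n∨m≡n m≤1+n
... | inj₁ m<1+n = ≤-trans (nondecreasing-by-steps step (s≤s⁻¹ m<1+n)) (step n)
... | inj₂ refl  = ≤-refl

strictlyIncreasing-by-steps : (∀ n → u n < u (suc n)) → StrictlyIncreasing u
strictlyIncreasing-by-steps step {m} {suc n} m<1+n with m≤n⇒m<n∨m≡n (s≤s⁻¹ m<1+n)
... | inj₁ m<n  = <-trans (strictlyIncreasing-by-steps step m<n) (step n)
... | inj₂ refl = step n

strictlyIncreasing⇒nondecreasing : StrictlyIncreasing u → Nondecreasing u
strictlyIncreasing⇒nondecreasing u-inc m≤n with m≤n⇒m<n∨m≡n m≤n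
... | inj₁ m<n  = <⇒≤ (u-inc m<n)
... | inj₂ refl = ≤-refl

strictlyIncreasing-reflects-< : StrictlyIncreasing u → ∀ {m n} → u m < u n → m < n
strictlyIncreasing-reflects-< u-inc um<un =
  ≰⇒> (λ n≤m → <⇒≱ um<un (strictlyIncreasing⇒nondecreasing u-inc n≤m))

strictlyIncreasing⇒injective : StrictlyIncreasing u → Injective u
strictlyIncreasing⇒injective u-inc um≡un =
  ≤-antisym (≮⇒≥ (λ n<m → <⇒≢ (u-inc n<m) (sym um≡un)))
            (≮⇒≥ (λ m<n → <⇒≢ (u-inc m<n) um≡un))

strictlyIncreasing⇒inflationary : StrictlyIncreasing u → ∀ n → n ≤ u n
strictlyIncreasing⇒inflationary u-inc zero    = z≤n
strictlyIncreasing⇒inflationary u-inc (suc n) =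
  ≤-<-trans (strictlyIncreasing⇒inflationary u-inc n) (u-inc (n<1+n n))

section-on-range : (∀ n → n ≤ u n) → ∃ λ v → ∀ {x} → Range u x → u (v x) ≡ x
section-on-range {u} u-infl = v , v-section
  where
  preimage? : ∀ x → Dec (∃ λ n → n < suc x × u n ≡ x)
  preimage? x = anyUpTo? (λ n → u n ≟ x) (suc x)

  v : ℕ → ℕ
  v x with preimage? x
  ... | yes (n , _) = n
  ... | no _        = 0

  v-section : ∀ {x} → Range u x → u (v x) ≡ x
  v-section {x} (n , un≡x) with preimage? x
  ... | yes (_ , _ , um≡x) = um≡x
  ... | no none = ⊥-elim (none (n , s≤s (subst (n ≤_) un≡x (u-infl n)) , un≡x))

nondecreasing-extension : Decidable D → (f : ℕ → ℕ) →
  (∀ {x y} → D x → D y → x < y → f x ≤ f y) →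
  ∃ λ H → Nondecreasing H × (∀ {x} → D x → f x ≡ H x)
nondecreasing-extension {D} D? f f-mono = H , nondecreasing-by-steps H-step , H-agrees
  where
  H : ℕ → ℕ
  H zero with D? zero
  ... | yes _ = f zero
  ... | no _  = 0
  H (suc n) with D? (suc n)
  ... | yes _ = f (suc n)
  ... | no _  = H n

  H-below : ∀ n {y} → D y → n < y → H n ≤ f y
  H-below zero Dy 0<y with D? zero
  ... | yes D0 = f-mono D0 Dy 0<y
  ... | no _   = z≤n
  H-below (suc n) Dy n+1<y with D? (suc n)
  ... | yes Dn+1 = f-mono Dn+1 Dy n+1<y
  ... | no _     = H-below n Dy (<-trans (n<1+n n) n+1<y)

  H-step : ∀ n → H n ≤ H (suc n)
  H-step n with D? (suc n)
  ... | yes Dn+1 = H-below n Dn+1 (n<1+n n)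
  ... | no _     = ≤-refl

  H-agrees : ∀ {x} → D x → f x ≡ H x
  H-agrees {zero} D0 with D? zero
  ... | yes _ = refl
  ... | no ¬D0 = ⊥-elim (¬D0 D0)
  H-agrees {suc n} Dn+1 with D? (suc n)
  ... | yes _ = refl
  ... | no ¬Dn+1 = ⊥-elim (¬Dn+1 Dn+1)

injectiveOn-if-no-<-collision :
  (∀ {x y} → D x → D y → g x ≡ g y → ¬ x < y) → InjectiveOn g D
injectiveOn-if-no-<-collision no-collision {x} {y} Dx Dy gx≡gy with <-cmp x y
... | tri< x<y _ _ = ⊥-elim (no-collision Dx Dy gx≡gy x<y)
... | tri≈ _ x≡y _ = x≡y
... | tri> _ _ y<x = ⊥-elim (no-collision Dy Dx (sym gx≡gy) y<x)

descending-on-fibres⇒injectiveOn : {H : ℕ → ℕ} → Nondecreasing H → (∀ {x} → D x → φ x ≡ H x) →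
  (∀ {x y} → D x → D y → g x ≡ g y → x < y → φ y < φ x) → InjectiveOn g D
descending-on-fibres⇒injectiveOn H-mono φ≡H descends =
  injectiveOn-if-no-<-collision λ Dx Dy gx≡gy x<y →
    <⇒≱ (descends Dx Dy gx≡gy x<y)
        (subst₂ _≤_ (sym (φ≡H Dx)) (sym (φ≡H Dy)) (H-mono (<⇒≤ x<y)))

agreement-injectiveOn : {h : ℕ → ℕ} → Injective h → InjectiveOn g (λ x → g x ≡ h x)
agreement-injectiveOn h-inj gx≡hx gy≡hy gx≡gy = h-inj (trans (sym gx≡hx) (trans gx≡gy gy≡hy))

inParity : Parity → ℕ → ℕ
inParity 0ℙ n = 2 * n
inParity 1ℙ n = suc (2 * n)

parity-inParity : ∀ p n → parity (inParity p n) ≡ p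
parity-inParity 0ℙ n = ℙ.*-homo-* 2 n
parity-inParity 1ℙ n = trans (ℙ.+-homo-+ 1 (2 * n)) (cong _⁻¹ (ℙ.*-homo-* 2 n))

inParity-injective : ∀ p {m n} → inParity p m ≡ inParity p n → m ≡ n
inParity-injective 0ℙ eq = *-cancelˡ-≡ _ _ 2 eq
inParity-injective 1ℙ eq = *-cancelˡ-≡ _ _ 2 (suc-injective eq)

injective-extension : Decidable D → InjectiveOn g D → ∀ p →
  ∃ λ h → Injective h × (∀ {x} → D x → parity (g x) ≡ p → g x ≡ h x)
injective-extension {D} {g} D? g-inj p = h , h-injective , h-agrees
  where
  kept? : ∀ x → Dec (D x × parity (g x) ≡ p)
  kept? x = D? x ×-dec (parity (g x) ℙ.≟ p)

  h : ℕ → ℕ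
  h x with kept? x
  ... | yes _ = g x
  ... | no _  = inParity (p ⁻¹) x

  h-injective : Injective h
  h-injective {m} {n} hm≡hn with kept? m | kept? n
  ... | yes (Dm , _)  | yes (Dn , _)  = g-inj Dm Dn hm≡hn
  ... | yes (_ , gm∈p) | no _ =
    ⊥-elim (ℙ.p≢p⁻¹ p (trans (sym gm∈p) (trans (cong parity hm≡hn) (parity-inParity (p ⁻¹) n))))
  ... | no _ | yes (_ , gn∈p) =
    ⊥-elim (ℙ.p≢p⁻¹ p (trans (sym gn∈p) (trans (cong parity (sym hm≡hn)) (parity-inParity (p ⁻¹) m))))
  ... | no _ | no _ = inParity-injective (p ⁻¹) hm≡hn

  h-agrees : ∀ {x} → D x → parity (g x) ≡ p → g x ≡ h x
  h-agrees {x} Dx gx∈p with kept? x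
  ... | yes _ = refl
  ... | no ¬kept = ⊥-elim (¬kept (Dx , gx∈p))

module FibreMaximum {g : ℕ → ℕ} (g-itv : IntervalToOne g) {gp : ℕ → ℕ} (gp-max : IsGPlus g gp) where

  g∘gp : ∀ x → g (gp x) ≡ g x
  g∘gp x = proj₁ (gp-max x)

  ≤gp : g z ≡ g x → z ≤ gp x
  ≤gp {x = x} = proj₂ (gp-max x) _

  x≤gp : ∀ x → x ≤ gp x
  x≤gp x = ≤gp refl

  gp-cong : g x ≡ g y → gp x ≡ gp y
  gp-cong {x} {y} gx≡gy = ≤-antisym (≤gp (trans (g∘gp x) gx≡gy)) (≤gp (trans (g∘gp y) (sym gx≡gy)))

  gp≡gp⇒g≡g : gp x ≡ gp y → g x ≡ g y
  gp≡gp⇒g≡g {x} {y} gpx≡gpy = trans (sym (g∘gp x)) (trans (cong g gpx≡gpy) (g∘gp y))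

  g-constant-up-to-gp : x ≤ y → y ≤ gp x → g y ≡ g x
  g-constant-up-to-gp {x} x≤y y≤gpx = g-itv x≤y y≤gpx (sym (g∘gp x))

  gp-bounded : x ≤ gp y → gp x ≤ gp y
  gp-bounded {x} {y} x≤gpy with ≤-total (gp x) (gp y)
  ... | inj₁ gpx≤gpy = gpx≤gpy
  ... | inj₂ gpy≤gpx =
    ≤gp (trans (g∘gp x) (trans (sym (g-constant-up-to-gp x≤gpy gpy≤gpx)) (g∘gp y)))

  gp-nondecreasing : Nondecreasing gp
  gp-nondecreasing {n = n} m≤n = gp-bounded (≤-trans m≤n (x≤gp n))

  gp<gp⇒gp< : gp y < gp x → gp y < x
  gp<gp⇒gp< gpy<gpx = ≰⇒> (λ x≤gpy → <⇒≱ gpy<gpx (gp-bounded x≤gpy))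

  gap-descends : g x ≡ g y → x < y → gp y ∸ y < gp x ∸ x
  gap-descends {x} {y} gx≡gy x<y =
    subst (λ m → gp y ∸ y < m ∸ x) (sym (gp-cong gx≡gy)) (∸-monoʳ-< x<y (x≤gp y))

  injectiveOn⇒gp< : InjectiveOn g D → D x → D y → x < y → gp x < y
  injectiveOn⇒gp< g-inj Dx Dy x<y =
    ≰⇒> (λ y≤gpx → <⇒≢ x<y (sym (g-inj Dy Dx (g-constant-up-to-gp (<⇒≤ x<y) y≤gpx))))

  below-gp-monotone-above-diagonal : InjectiveOn g D → (f : ℕ → ℕ) → (∀ x → f x ≤ gp x) →
    ∀ {x y} → D x × x < f x → D y × y < f y → x < y → f x ≤ f y
  below-gp-monotone-above-diagonal g-inj f f≤gp {x} (Dx , _) (Dy , y<fy) x<y =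
    ≤-trans (f≤gp x) (<⇒≤ (<-trans (injectiveOn⇒gp< g-inj Dx Dy x<y) y<fy))

  module Enumeration {e : ℕ → ℕ} (e-enum : IsIncreasingEnumOfRange gp e) where

    e-inc : StrictlyIncreasing e
    e-inc = proj₁ e-enum

    rank : ℕ → ℕ
    rank x = proj₁ (proj₂ (proj₂ e-enum) x)

    e∘rank : ∀ x → e (rank x) ≡ gp x
    e∘rank x = proj₂ (proj₂ (proj₂ e-enum) x)

    rank-cong : g x ≡ g y → rank x ≡ rank y
    rank-cong {x} {y} gx≡gy =
      strictlyIncreasing⇒injective e-inc (trans (e∘rank x) (trans (gp-cong gx≡gy) (sym (e∘rank y))))

    e<⇒<rank : e j < x → j < rank x
    e<⇒<rank {x = x} ej<x =
      strictlyIncreasing-reflects-< e-inc (<-≤-trans ej<x (subst (x ≤_) (sym (e∘rank x)) (x≤gp x)))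

    e<gp⇒e< : e j < gp x → e j < x
    e<gp⇒e< {j} ej<gpx with proj₁ (proj₂ e-enum) j
    ... | y , gpy≡ej = subst (_< _) gpy≡ej (gp<gp⇒gp< (subst (_< _) (sym gpy≡ej) ej<gpx))

    below-block : e (suc j) ≡ gp x → e j < x
    below-block {j} e[1+j]≡gpx = e<gp⇒e< (subst (e j <_) e[1+j]≡gpx (e-inc (n<1+n j)))

    in-block : e 0 < x → ∃ λ j → e j < x × gp x ≡ e (suc j)
    in-block {x} e0<x with rank x | e∘rank x
    ... | zero  | e0≡gpx = ⊥-elim (<⇒≱ e0<x (subst (x ≤_) (sym e0≡gpx) (x≤gp x)))
    ... | suc j | e[1+j]≡gpx =
      j , below-block e[1+j]≡gpx , sym e[1+j]≡gpx

    rank≤ : ∀ x → rank x ≤ x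
    rank≤ x with rank x | e∘rank x
    ... | zero  | _ = z≤n
    ... | suc j | e[1+j]≡gpx =
      ≤-<-trans (strictlyIncreasing⇒inflationary e-inc j) (below-block e[1+j]≡gpx)

    gp-on-block : e j < z → z ≤ e (suc j) → gp z ≡ e (suc j)
    gp-on-block {j} {z} ej<z z≤e[1+j] = ≤-antisym
      (≮⇒≥ (λ e[1+j]<gpz → <⇒≱ (e<gp⇒e< e[1+j]<gpz) z≤e[1+j]))
      (subst (e (suc j) ≤_) (e∘rank z) (strictlyIncreasing⇒nondecreasing e-inc (e<⇒<rank ej<z)))

module UltrafilterFacts (𝒰 : Ultrafilter) where

  _∈𝒰 : Subset → Set
  A ∈𝒰 = _∈U 𝒰 A

  𝒰-Nondecreasing : (ℕ → ℕ) → Set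
  𝒰-Nondecreasing f = ∃ λ H → Nondecreasing H × (f ≡[ 𝒰 ] H)

  𝒰-Injective : (ℕ → ℕ) → Set
  𝒰-Injective g = ∃ λ h → Injective h × (g ≡[ 𝒰 ] h)

  LargeSetAbove : (ℕ → ℕ) → Set
  LargeSetAbove f = ∃ λ u → StrictlyIncreasing u × Range u ∈𝒰 × (∀ n → f n < u n)

  tail∈𝒰 : NonPrincipal 𝒰 → ∀ m → (λ n → m ≤ n) ∈𝒰
  tail∈𝒰 nonprincipal zero    = upward 𝒰 (full 𝒰) (λ _ _ → z≤n)
  tail∈𝒰 nonprincipal (suc m) =
    upward 𝒰 (inter 𝒰 (tail∈𝒰 nonprincipal m) (nonprincipal m))
      (λ n (m≤n , n≢m) → ≤∧≢⇒< m≤n (n≢m ∘ sym))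

  some-parity-class∈𝒰 : (φ : ℕ → ℕ) → ∃ λ p → (λ x → parity (φ x) ≡ p) ∈𝒰
  some-parity-class∈𝒰 φ with ultra 𝒰 (λ x → parity (φ x) ≡ 0ℙ)
  ... | inj₁ even∈𝒰 = 0ℙ , even∈𝒰
  ... | inj₂ odd∈𝒰  = 1ℙ , upward 𝒰 odd∈𝒰 (λ x → ≢0ℙ⇒≡1ℙ)
    where
    ≢0ℙ⇒≡1ℙ : ∀ {p} → ¬ p ≡ 0ℙ → p ≡ 1ℙ
    ≢0ℙ⇒≡1ℙ {0ℙ} p≢0ℙ = ⊥-elim (p≢0ℙ refl)
    ≢0ℙ⇒≡1ℙ {1ℙ} _    = refl

  below-identity⇒𝒰-nondecreasing : QuasiSelective 𝒰 → ∀ f → (λ x → f x ≤ x) ∈𝒰 →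
    𝒰-Nondecreasing f
  below-identity⇒𝒰-nondecreasing (_ , quasiSelective) f below =
    let H , H-mono , f⊓id≡H = quasiSelective (λ x → f x ⊓ x) (λ x → m⊓n≤n (f x) x)
    in H , H-mono ,
       upward 𝒰 (inter 𝒰 below f⊓id≡H) (λ x (fx≤x , eq) → trans (sym (m≤n⇒m⊓n≡m fx≤x)) eq)

  injectiveOn⇒𝒰-injective : Decidable D → D ∈𝒰 → InjectiveOn g D → 𝒰-Injective g
  injectiveOn⇒𝒰-injective {D} {g} D? D∈𝒰 g-inj =
    let p , class∈𝒰 = some-parity-class∈𝒰 g
        h , h-inj , g≡h = injective-extension D? g-inj p
    in h , h-inj , upward 𝒰 (inter 𝒰 D∈𝒰 class∈𝒰) (λ x (Dx , gx∈p) → g≡h Dx gx∈p)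

module Proposition (𝒰 : Ultrafilter) (qs : QuasiSelective 𝒰)
  {g : ℕ → ℕ} (g-itv : IntervalToOne g) {gp : ℕ → ℕ} (gp-max : IsGPlus g gp)
  {e : ℕ → ℕ} (e-enum : IsIncreasingEnumOfRange gp e) where

  open UltrafilterFacts 𝒰
  open FibreMaximum g-itv gp-max
  open Enumeration e-enum

  𝒰-injective⇒InF : 𝒰-Injective g → InF 𝒰 gp
  𝒰-injective⇒InF (h , h-inj , g≡h) = gp-nondecreasing , below-gp
    where
    below-gp : ∀ f → (∀ x → f x ≤ gp x) → 𝒰-Nondecreasing f
    below-gp f f≤gp with ultra 𝒰 (λ x → x < f x)
    ... | inj₂ ≮∈𝒰 = below-identity⇒𝒰-nondecreasing qs f (upward 𝒰 ≮∈𝒰 (λ _ → ≮⇒≥))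
    ... | inj₁ above∈𝒰 =
      let H , H-mono , f≡H =
            nondecreasing-extension (λ x → (g x ≟ h x) ×-dec (x <? f x)) f
              (below-gp-monotone-above-diagonal (agreement-injectiveOn h-inj) f f≤gp)
      in H , H-mono , upward 𝒰 (inter 𝒰 g≡h above∈𝒰) (λ _ → f≡H)

  InF⇒𝒰-injective : InF 𝒰 gp → 𝒰-Injective g
  InF⇒𝒰-injective (_ , below-gp) =
    let H , H-mono , gap≡H = below-gp (λ x → gp x ∸ x) (λ x → m∸n≤m (gp x) x)
    in injectiveOn⇒𝒰-injective (λ x → gp x ∸ x ≟ H x) gap≡H
         (descending-on-fibres⇒injectiveOn H-mono (λ eq → eq) (λ _ _ → gap-descends))

  𝒰-injective⇒above-e : 𝒰-Injective g → LargeSetAbove e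
  𝒰-injective⇒above-e (h , h-inj , g≡h) =
    pick , strictlyIncreasing-by-steps pick-step , range∈𝒰 , (λ n → proj₁ (pick-in-block n))
    where
    Agrees : Subset
    Agrees x = g x ≡ h x

    candidate? : ∀ n → Dec (∃ λ z → z < suc (e (suc n)) × (e n < z × Agrees z))
    candidate? n = anyUpTo? (λ z → (e n <? z) ×-dec (g z ≟ h z)) (suc (e (suc n)))

    pick : ℕ → ℕ
    pick n with candidate? n
    ... | yes (z , _) = z
    ... | no _        = suc (e n)

    pick-in-block : ∀ n → e n < pick n × pick n ≤ e (suc n)
    pick-in-block n with candidate? n
    ... | yes (_ , z<1+e[1+n] , en<z , _) = en<z , s≤s⁻¹ z<1+e[1+n]
    ... | no _ = ≤-refl , e-inc (n<1+n n)

    pick-step : ∀ n → pick n < pick (suc n)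
    pick-step n = ≤-<-trans (proj₂ (pick-in-block n)) (proj₁ (pick-in-block (suc n)))

    pick-agrees : ∀ {n z} → e n < z → z ≤ e (suc n) → Agrees z → Agrees (pick n)
    pick-agrees {n} {z} en<z z≤e[1+n] z-agrees with candidate? n
    ... | yes (_ , _ , _ , agrees) = agrees
    ... | no none = ⊥-elim (none (z , s≤s z≤e[1+n] , en<z , z-agrees))

    -- pick j is the only point of Agrees in the block of x, as g is injective on Agrees.
    covers : ∀ {x} → Agrees x → e 0 < x → Range pick x
    covers {x} x-agrees e0<x =
      let j , ej<x , gpx≡e[1+j] = in-block e0<x
          x≤e[1+j] = subst (x ≤_) gpx≡e[1+j] (x≤gp x)
          pick-j = pick-in-block j
      in j , agreement-injectiveOn {g = g} h-inj (pick-agrees ej<x x≤e[1+j] x-agrees) x-agrees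
               (gp≡gp⇒g≡g (trans (gp-on-block (proj₁ pick-j) (proj₂ pick-j)) (sym gpx≡e[1+j])))

    range∈𝒰 : Range pick ∈𝒰
    range∈𝒰 = upward 𝒰 (inter 𝒰 g≡h (tail∈𝒰 (proj₁ qs) (suc (e 0))))
                (λ x (x-agrees , e0<x) → covers x-agrees e0<x)

  position-descends : StrictlyIncreasing u → (∀ n → e n < u n) → {v : ℕ → ℕ} →
    u (v x) ≡ x → u (v y) ≡ y → g x ≡ g y → x < y → rank y ∸ suc (v y) < rank x ∸ suc (v x)
  position-descends {u} {x} {y} u-inc e<u {v} uvx≡x uvy≡y gx≡gy x<y =
    subst (λ r → rank y ∸ suc (v y) < r ∸ suc (v x)) (sym (rank-cong gx≡gy))
      (∸-monoʳ-< (s≤s vx<vy) (e<⇒<rank (subst (e (v y) <_) uvy≡y (e<u (v y)))))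
    where
    vx<vy : v x < v y
    vx<vy = strictlyIncreasing-reflects-< u-inc (subst₂ _<_ (sym uvx≡x) (sym uvy≡y) x<y)

  above-e⇒𝒰-injective : LargeSetAbove e → 𝒰-Injective g
  above-e⇒𝒰-injective (u , u-inc , range∈𝒰 , e<u) =
    let v , v-section = section-on-range (strictlyIncreasing⇒inflationary u-inc)
        ψ : ℕ → ℕ
        ψ x = rank x ∸ suc (v x)
        H , H-mono , ψ≡H = proj₂ qs ψ (λ x → ≤-trans (m∸n≤m (rank x) (suc (v x))) (rank≤ x))
    in injectiveOn⇒𝒰-injective (λ x → (u (v x) ≟ x) ×-dec (ψ x ≟ H x))
         (upward 𝒰 (inter 𝒰 range∈𝒰 ψ≡H) (λ x (x∈range , ψx≡Hx) → v-section x∈range , ψx≡Hx))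
         (descending-on-fibres⇒injectiveOn H-mono proj₂
           (λ (uvx≡x , _) (uvy≡y , _) → position-descends u-inc e<u uvx≡x uvy≡y))

proposition1p5 : (𝒰 : Ultrafilter) → QuasiSelective 𝒰 →
    (g : ℕ → ℕ) → Unbounded g → IntervalToOne g →
    (gp : ℕ → ℕ) → IsGPlus g gp →
    (e : ℕ → ℕ) → IsIncreasingEnumOfRange gp e →
    ((∃ λ h → Injective h × (g ≡[ 𝒰 ] h)) ⇔ InF 𝒰 gp) ×
    (InF 𝒰 gp ⇔ (∃ λ u → StrictlyIncreasing u × _∈U 𝒰 (Range u) × (∀ n → e n < u n)))
proposition1p5 𝒰 qs g _ g-itv gp gp-max e e-enum =
  mk⇔ 𝒰-injective⇒InF InF⇒𝒰-injective ,
  mk⇔ (𝒰-injective⇒above-e ∘ InF⇒𝒰-injective) (𝒰-injective⇒InF ∘ above-e⇒𝒰-injective)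
  where open Proposition 𝒰 qs g-itv gp-max e-enum
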